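{- For every $n\ge1$, every $n\times n$ Tesler matrix is obtained from the $1\times1$ matrix $(1)$ by $n-1$ successive applications of the extension step described in the context (with suitable choices at each step). Equivalently, every $(n+1)\times(n+1)$ Tesler matrix is an extension of some $n\times n$ Tesler matrix.
   Context: Let $U_n$ be the set of $n\times n$ upper-triangular matrices with nonnegative integer entries. For $A=(a_{i,j})\in U_n$, the $k$-th hook sum is $h_k=(a_{k,k}+\cdots+a_{k,n})-(a_{1,k}+\cdots+a_{k-1,k})$; a Tesler matrix is one with $h_k=1$ for all $1\le k\le n$. Extension step: given an $n\times n$ Tesler matrix $A=(a_{ij})$, choose integers $d_i'$ with $0\le d_i'\le a_{ii}$ for $1\le i\le n$, and form the $(n+1)\times(n+1)$ upper-triangular matrix $A'=(a'_{ij})$ with $a'_{ij}=a_{ij}$ for $1\le i<j\le n$, $a'_{ii}=d_i'$ for $i\le n$, $a'_{i,n+1}=a_{ii}-d_i'$ for $i\le n$, and $a'_{n+1,n+1}=1+\sum_{i=1}^n(a_{ii}-d_i')$ (so that the diagonal of $A'$ sums to $n+1$). Such an $A'$ is an $(n+1)\times(n+1)$ Tesler matrix, called an extension of $A$. -}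

module Defs where

open import Data.Nat using (ℕ; zero; suc; _+_; _∸_; _≤_; _<_)
open import Data.Nat.Properties using (_≤?_; _<?_)
open import Data.Fin using (Fin; zero; suc; toℕ; inject₁; fromℕ)
open import Relation.Nullary using (Dec; yes; no)
open import Relation.Binary.PropositionalEquality using (_≡_)
open import Data.Product using (Σ; _×_; ∃-syntax)

-- An n×n matrix with nonnegative integer entries, indexed by Fin n
-- (index i : Fin n corresponds to row/column toℕ i + 1 of the paper).
Matrix : ℕ → Set
Matrix n = Fin n → Fin n → ℕ

∑ : ∀ {n} → (Fin n → ℕ) → ℕ
∑ {zero}  f = 0
∑ {suc n} f = f zero + ∑ (λ i → f (suc i))

when : ∀ {P : Set} → Dec P → ℕ → ℕ
when (yes _) x = x
when (no _)  x = 0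

UpperTriangular : ∀ {n} → Matrix n → Set
UpperTriangular {n} A = ∀ (i j : Fin n) → toℕ j < toℕ i → A i j ≡ 0

rowPart : ∀ {n} → Matrix n → Fin n → ℕ
rowPart A k = ∑ (λ j → when (toℕ k ≤? toℕ j) (A k j))

colPart : ∀ {n} → Matrix n → Fin n → ℕ
colPart A k = ∑ (λ i → when (toℕ i <? toℕ k) (A i k))

-- Tesler: upper triangular and every hook sum h_k = rowPart - colPart equals 1
-- (stated over ℕ as rowPart = 1 + colPart, equivalent to the ℤ equation).
Tesler : ∀ {n} → Matrix n → Set
Tesler {n} A = UpperTriangular A × (∀ (k : Fin n) → rowPart A k ≡ 1 + colPart A k)

data LastView : ∀ {n} → Fin (suc n) → Set where
  old : ∀ {n} (i : Fin n) → LastView (inject₁ i)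
  new : ∀ {n} → LastView (fromℕ n)

lastView : ∀ {n} (i : Fin (suc n)) → LastView i
lastView {zero}  zero    = new
lastView {suc n} zero    = old zero
lastView {suc n} (suc i) with lastView i
... | old j = old (suc j)
... | new   = new

-- The extension step: given A (n×n) and choices d (intended d i ≤ a_ii),
-- the (n+1)×(n+1) matrix A' of the paper.
extend : ∀ {n} → Matrix n → (Fin n → ℕ) → Matrix (suc n)
extend {n} A d i j = go (lastView i) (lastView j)
  where
  go : ∀ {i j : Fin (suc n)} → LastView i → LastView j → ℕ
  go (old a) (old b) with toℕ a <? toℕ b | toℕ b <? toℕ a
  ... | yes _ | _     = A a b
  ... | no _  | yes _ = 0
  ... | no _  | no _  = d a
  go (old a) new     = A a a ∸ d a
  go new     (old b) = 0
  go new     new     = 1 + ∑ (λ a → A a a ∸ d a)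

IsExtension : ∀ {n} → Matrix n → Matrix (suc n) → Set
IsExtension {n} A A' =
  Σ (Fin n → ℕ) λ d → (∀ i → d i ≤ A i i) × (∀ i j → A' i j ≡ extend A d i j)

one₁ : Matrix 1
one₁ _ _ = 1

data Reachable : (n : ℕ) → Matrix n → Set where
  base : ∀ {A : Matrix 1} → (∀ i j → A i j ≡ one₁ i j) → Reachable 1 A
  step : ∀ {n} {A : Matrix n} {A' : Matrix (suc n)} →
         Reachable n A → IsExtension A A' → Reachable (suc n) A'

-- Deleting the last row and column of an (n+1)×(n+1) Tesler matrix A' and adding the
-- deleted column a'_{i,n+1} to the diagonal gives an n×n matrix A. For k ≤ n the entry
-- a'_{k,n+1} moves from the k-th row sum onto the diagonal, so the row sums and column
-- sums of A agree with those of A' and A is Tesler; the last hook sum of A' says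
-- a'_{n+1,n+1} = 1 + Σ a'_{i,n+1}, which is exactly the last diagonal entry of the
-- extension of A with choices d'_i = a'_{ii}. Iterating down to size 1 reaches (1).
module Submission where

open import Defs
open import Data.Nat using (ℕ; zero; suc; _+_; _∸_; _≤_; _<_; z≤n; s≤s)
open import Data.Nat.Properties
  using (_≤?_; _<?_; +-identityʳ; +-assoc; +-comm; ≤-refl; ≤-reflexive; <⇒≤; <⇒≢; <⇒≱; <⇒≯;
         n≮n; ≤-antisym; ≮⇒≥; m≤m+n; m+n∸m≡n; +-commutativeSemigroup)
open import Data.Fin using (Fin; zero; suc; toℕ; inject₁; fromℕ)
open import Data.Fin.Properties using (toℕ-inject₁; toℕ-fromℕ; toℕ-injective; inject₁ℕ<)
open import Data.Product using (Σ; _×_; _,_)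
open import Function using (_∘′_)
open import Relation.Nullary using (Dec; yes; no; ¬_; contradiction)
open import Relation.Binary.PropositionalEquality
open import Algebra.Properties.CommutativeSemigroup +-commutativeSemigroup using (interchange)

open ≡-Reasoning

∑-cong : ∀ {n} {f g : Fin n → ℕ} → (∀ i → f i ≡ g i) → ∑ f ≡ ∑ g
∑-cong {zero}  f≗g = refl
∑-cong {suc n} f≗g = cong₂ _+_ (f≗g zero) (∑-cong (λ i → f≗g (suc i)))

∑-zero : ∀ n → ∑ {n} (λ _ → 0) ≡ 0
∑-zero zero    = refl
∑-zero (suc n) = ∑-zero n

∑-distrib-+ : ∀ {n} (f g : Fin n → ℕ) → ∑ (λ i → f i + g i) ≡ ∑ f + ∑ g
∑-distrib-+ {zero}  f g = refl
∑-distrib-+ {suc n} f g =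
  trans (cong (f zero + g zero +_) (∑-distrib-+ (λ i → f (suc i)) (λ i → g (suc i))))
        (interchange (f zero) (g zero) _ _)

∑-init-last : ∀ {n} (f : Fin (suc n) → ℕ) → ∑ f ≡ ∑ (λ i → f (inject₁ i)) + f (fromℕ n)
∑-init-last {zero}  f = +-comm (f zero) 0
∑-init-last {suc n} f =
  trans (cong (f zero +_) (∑-init-last (λ i → f (suc i)))) (sym (+-assoc (f zero) _ _))

when-yes : ∀ {P : Set} (p? : Dec P) x → P → when p? x ≡ x
when-yes (yes _) x p = refl
when-yes (no ¬p) x p = contradiction p ¬p

when-no : ∀ {P : Set} (p? : Dec P) x → ¬ P → when p? x ≡ 0
when-no (yes p) x ¬p = contradiction p ¬p
when-no (no _)  x ¬p = refl

when-+-extract : ∀ {P : Set} (p? : Dec P) x y → (¬ P → y ≡ 0) → when p? (x + y) ≡ when p? x + y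
when-+-extract (yes _) x y y≡0 = refl
when-+-extract (no ¬p) x y y≡0 = sym (y≡0 ¬p)

when-+-discard : ∀ {P : Set} (p? : Dec P) x y → (P → y ≡ 0) → when p? (x + y) ≡ when p? x
when-+-discard (yes p) x y y≡0 = trans (cong (x +_) (y≡0 p)) (+-identityʳ x)
when-+-discard (no _)  x y y≡0 = refl

diagonal : ∀ {n} → (Fin n → ℕ) → Matrix n
diagonal x zero    zero    = x zero
diagonal x zero    (suc j) = 0
diagonal x (suc i) zero    = 0
diagonal x (suc i) (suc j) = diagonal (λ k → x (suc k)) i j

diagonal-on : ∀ {n} (x : Fin n → ℕ) i → diagonal x i i ≡ x i
diagonal-on x zero    = refl
diagonal-on x (suc i) = diagonal-on (λ k → x (suc k)) i

diagonal-off : ∀ {n} (x : Fin n → ℕ) i j → toℕ i ≢ toℕ j → diagonal x i j ≡ 0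
diagonal-off x zero    zero    i≢j = contradiction refl i≢j
diagonal-off x zero    (suc j) i≢j = refl
diagonal-off x (suc i) zero    i≢j = refl
diagonal-off x (suc i) (suc j) i≢j = diagonal-off (λ k → x (suc k)) i j (i≢j ∘′ cong suc)

∑-diagonal-row : ∀ {n} (x : Fin n → ℕ) k → ∑ (diagonal x k) ≡ x k
∑-diagonal-row {suc n} x zero    = trans (cong (x zero +_) (∑-zero n)) (+-identityʳ (x zero))
∑-diagonal-row         x (suc k) = ∑-diagonal-row (λ i → x (suc i)) k

addDiagonal : ∀ {n} → Matrix n → (Fin n → ℕ) → Matrix n
addDiagonal B x i j = B i j + diagonal x i j

rowPart-addDiagonal : ∀ {n} (B : Matrix n) x k → rowPart (addDiagonal B x) k ≡ rowPart B k + x k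
rowPart-addDiagonal B x k = begin
  ∑ (λ j → when (toℕ k ≤? toℕ j) (B k j + diagonal x k j))
    ≡⟨ ∑-cong (λ j → when-+-extract (toℕ k ≤? toℕ j) _ _
                       (λ k≰j → diagonal-off x k j (λ k≡j → k≰j (≤-reflexive k≡j)))) ⟩
  ∑ (λ j → when (toℕ k ≤? toℕ j) (B k j) + diagonal x k j)
    ≡⟨ ∑-distrib-+ _ (diagonal x k) ⟩
  rowPart B k + ∑ (diagonal x k)
    ≡⟨ cong (rowPart B k +_) (∑-diagonal-row x k) ⟩
  rowPart B k + x k ∎

colPart-addDiagonal : ∀ {n} (B : Matrix n) x k → colPart (addDiagonal B x) k ≡ colPart B k
colPart-addDiagonal B x k =
  ∑-cong (λ i → when-+-discard (toℕ i <? toℕ k) _ _ (λ i<k → diagonal-off x i k (<⇒≢ i<k)))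

topLeft : ∀ {n} → Matrix (suc n) → Matrix n
topLeft M i j = M (inject₁ i) (inject₁ j)

lastColumn : ∀ {n} → Matrix (suc n) → Fin n → ℕ
lastColumn {n} M i = M (inject₁ i) (fromℕ n)

UpperTriangular-topLeft : ∀ {n} {M : Matrix (suc n)} → UpperTriangular M → UpperTriangular (topLeft M)
UpperTriangular-topLeft upper i j j<i =
  upper (inject₁ i) (inject₁ j) (subst₂ _<_ (sym (toℕ-inject₁ j)) (sym (toℕ-inject₁ i)) j<i)

inject₁<fromℕ : ∀ {n} (i : Fin n) → toℕ (inject₁ i) < toℕ (fromℕ n)
inject₁<fromℕ {n} i = subst (toℕ (inject₁ i) <_) (sym (toℕ-fromℕ n)) (inject₁ℕ< i)

rowPart-inject₁ : ∀ {n} (M : Matrix (suc n)) k →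
                  rowPart M (inject₁ k) ≡ rowPart (topLeft M) k + lastColumn M k
rowPart-inject₁ {n} M k = begin
  rowPart M (inject₁ k)
    ≡⟨ ∑-init-last (λ j → when (toℕ (inject₁ k) ≤? toℕ j) (M (inject₁ k) j)) ⟩
  ∑ (λ j → when (toℕ (inject₁ k) ≤? toℕ (inject₁ j)) (topLeft M k j))
    + when (toℕ (inject₁ k) ≤? toℕ (fromℕ n)) (lastColumn M k)
    ≡⟨ cong₂ _+_
         (∑-cong (λ j → cong₂ (λ a b → when (a ≤? b) (topLeft M k j)) (toℕ-inject₁ k) (toℕ-inject₁ j)))
         (when-yes (_ ≤? _) _ (<⇒≤ (inject₁<fromℕ k))) ⟩
  rowPart (topLeft M) k + lastColumn M k ∎

colPart-inject₁ : ∀ {n} (M : Matrix (suc n)) k → colPart M (inject₁ k) ≡ colPart (topLeft M) k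
colPart-inject₁ {n} M k = begin
  colPart M (inject₁ k)
    ≡⟨ ∑-init-last (λ i → when (toℕ i <? toℕ (inject₁ k)) (M i (inject₁ k))) ⟩
  ∑ (λ i → when (toℕ (inject₁ i) <? toℕ (inject₁ k)) (topLeft M i k))
    + when (toℕ (fromℕ n) <? toℕ (inject₁ k)) (M (fromℕ n) (inject₁ k))
    ≡⟨ cong₂ _+_
         (∑-cong (λ i → cong₂ (λ a b → when (a <? b) (topLeft M i k)) (toℕ-inject₁ i) (toℕ-inject₁ k)))
         (when-no (_ <? _) _ (<⇒≯ (inject₁<fromℕ k))) ⟩
  colPart (topLeft M) k + 0
    ≡⟨ +-identityʳ _ ⟩
  colPart (topLeft M) k ∎

rowPart-fromℕ : ∀ {n} (M : Matrix (suc n)) → rowPart M (fromℕ n) ≡ M (fromℕ n) (fromℕ n)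
rowPart-fromℕ {n} M = begin
  rowPart M (fromℕ n)
    ≡⟨ ∑-init-last (λ j → when (toℕ (fromℕ n) ≤? toℕ j) (M (fromℕ n) j)) ⟩
  ∑ (λ j → when (toℕ (fromℕ n) ≤? toℕ (inject₁ j)) (M (fromℕ n) (inject₁ j)))
    + when (toℕ (fromℕ n) ≤? toℕ (fromℕ n)) (M (fromℕ n) (fromℕ n))
    ≡⟨ cong₂ _+_ (∑-cong {n} (λ j → when-no (_ ≤? _) _ (<⇒≱ (inject₁<fromℕ j))))
                 (when-yes (_ ≤? _) _ ≤-refl) ⟩
  ∑ {n} (λ _ → 0) + M (fromℕ n) (fromℕ n)
    ≡⟨ cong (_+ M (fromℕ n) (fromℕ n)) (∑-zero n) ⟩
  M (fromℕ n) (fromℕ n) ∎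

colPart-fromℕ : ∀ {n} (M : Matrix (suc n)) → colPart M (fromℕ n) ≡ ∑ (lastColumn M)
colPart-fromℕ {n} M = begin
  colPart M (fromℕ n)
    ≡⟨ ∑-init-last (λ i → when (toℕ i <? toℕ (fromℕ n)) (M i (fromℕ n))) ⟩
  ∑ (λ i → when (toℕ (inject₁ i) <? toℕ (fromℕ n)) (lastColumn M i))
    + when (toℕ (fromℕ n) <? toℕ (fromℕ n)) (M (fromℕ n) (fromℕ n))
    ≡⟨ cong₂ _+_ (∑-cong {n} (λ i → when-yes (_ <? _) _ (inject₁<fromℕ i)))
                 (when-no (toℕ (fromℕ n) <? toℕ (fromℕ n)) _ (n≮n _)) ⟩
  ∑ (lastColumn M) + 0
    ≡⟨ +-identityʳ _ ⟩
  ∑ (lastColumn M) ∎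

contract : ∀ {n} → Matrix (suc n) → Matrix n
contract M = addDiagonal (topLeft M) (lastColumn M)

Tesler-contract : ∀ {n} {M : Matrix (suc n)} → Tesler M → Tesler (contract M)
Tesler-contract {n} {M} (upper , hook) = upper′ , hook′
  where
  upper′ : UpperTriangular (contract M)
  upper′ i j j<i = cong₂ _+_ (UpperTriangular-topLeft upper i j j<i)
    (diagonal-off (lastColumn M) i j (λ i≡j → <⇒≢ j<i (sym i≡j)))

  hook′ : ∀ k → rowPart (contract M) k ≡ 1 + colPart (contract M) k
  hook′ k = begin
    rowPart (contract M) k                    ≡⟨ rowPart-addDiagonal (topLeft M) (lastColumn M) k ⟩
    rowPart (topLeft M) k + lastColumn M k    ≡⟨ rowPart-inject₁ M k ⟨
    rowPart M (inject₁ k)                     ≡⟨ hook (inject₁ k) ⟩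
    1 + colPart M (inject₁ k)                 ≡⟨ cong suc (colPart-inject₁ M k) ⟩
    1 + colPart (topLeft M) k                 ≡⟨ cong suc (colPart-addDiagonal (topLeft M) (lastColumn M) k) ⟨
    1 + colPart (contract M) k                ∎

Tesler-last-diagonal : ∀ {n} {M : Matrix (suc n)} → Tesler M →
                       M (fromℕ n) (fromℕ n) ≡ 1 + ∑ (lastColumn M)
Tesler-last-diagonal {n} {M} (_ , hook) = begin
  M (fromℕ n) (fromℕ n)     ≡⟨ rowPart-fromℕ M ⟨
  rowPart M (fromℕ n)       ≡⟨ hook (fromℕ n) ⟩
  1 + colPart M (fromℕ n)   ≡⟨ cong suc (colPart-fromℕ M) ⟩
  1 + ∑ (lastColumn M)      ∎

contract-diagonal-∸ : ∀ {n} (M : Matrix (suc n)) i → contract M i i ∸ topLeft M i i ≡ lastColumn M i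
contract-diagonal-∸ M i =
  trans (cong (_∸ topLeft M i i) (cong (topLeft M i i +_) (diagonal-on (lastColumn M) i)))
        (m+n∸m≡n (topLeft M i i) (lastColumn M i))

extend-contract : ∀ {n} {M : Matrix (suc n)} → Tesler M →
                  ∀ i j → M i j ≡ extend (contract M) (λ k → topLeft M k k) i j
extend-contract T i j with lastView i | lastView j
extend-contract {M = M} (upper , _) _ _ | old a | old b with toℕ a <? toℕ b | toℕ b <? toℕ a
... | yes a<b | _       =
  sym (trans (cong (topLeft M a b +_) (diagonal-off (lastColumn M) a b (<⇒≢ a<b))) (+-identityʳ _))
... | no _    | yes b<a = UpperTriangular-topLeft upper a b b<a
... | no a≮b  | no b≮a  =
  cong (topLeft M a) (sym (toℕ-injective (≤-antisym (≮⇒≥ b≮a) (≮⇒≥ a≮b))))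
extend-contract {M = M} T _ _ | old a | new = sym (contract-diagonal-∸ M a)
extend-contract {n} (upper , _) _ _ | new | old b = upper (fromℕ n) (inject₁ b) (inject₁<fromℕ b)
extend-contract {M = M} T _ _ | new | new =
  trans (Tesler-last-diagonal T) (cong suc (∑-cong (λ i → sym (contract-diagonal-∸ M i))))

IsExtension-contract : ∀ {n} {M : Matrix (suc n)} → Tesler M → IsExtension (contract M) M
IsExtension-contract {M = M} T = (λ k → topLeft M k k) , (λ k → m≤m+n _ _) , extend-contract T

Tesler₁-unique : ∀ {A : Matrix 1} → Tesler A → ∀ i j → A i j ≡ one₁ i j
Tesler₁-unique {A} (_ , hook) zero zero = begin
  A zero zero         ≡⟨ +-identityʳ _ ⟨
  rowPart A zero      ≡⟨ hook zero ⟩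
  1 + colPart A zero  ≡⟨⟩
  1 + 0               ∎

Tesler⇒Reachable : ∀ n → 1 ≤ n → (A : Matrix n) → Tesler A → Reachable n A
Tesler⇒Reachable (suc zero)    _ A T = base (Tesler₁-unique T)
Tesler⇒Reachable (suc (suc n)) _ A T =
  step (Tesler⇒Reachable (suc n) (s≤s z≤n) (contract A) (Tesler-contract T)) (IsExtension-contract T)

mainTheorem3 : (∀ (n : ℕ) → 1 ≤ n → (A : Matrix n) → Tesler A → Reachable n A)
    × (∀ (n : ℕ) → 1 ≤ n → (A' : Matrix (suc n)) → Tesler A'
        → Σ (Matrix n) λ A → Tesler A × IsExtension A A')
mainTheorem3 =
  Tesler⇒Reachable ,
  λ n _ A' T → contract A' , Tesler-contract T , IsExtension-contract T
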